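{- Fix $d\geq1$ and $\underline{x}\in\mathbb Z_+^d$. There exists a unique infinite sequence $(X_k)_{k\geq 1}$ such that for every $k\geq1$ and every integer $n\geq 0$ with $n\geq \log_2 (k/d)$, $X_k$ is the $k$-th term of the finite sequence $f^n(\underline{x})$.
   Context: $\mathbb Z_+$ denotes the set of nonnegative integers and $S:=\bigsqcup_{d\geq1}\mathbb Z_+^d$ the set of all finite nonempty sequences of nonnegative integers. Define $f:S\to S$, mapping $\mathbb Z_+^d$ into $\mathbb Z_+^{2d}$, as follows. Let $\underline{x}=(x_1,\ldots,x_d)\in \mathbb Z_+^d$. If $x_i=x_d$ for all $i$, set $f(\underline{x})=(x_d,\ldots,x_d,2x_d,\ldots,2x_d)$, where $x_d$ and $2x_d$ each appear $d$ times. Otherwise, let $s:=\max\{1\leq i\leq d-1 : x_i\neq x_d\}$ and set $f(\underline{x})=(x_1,\ldots,x_d,\,x_1+x_d,\ldots,x_{s-1}+x_d,\,2x_d,\ldots,2x_d)$, where $2x_d$ appears $d-s+1$ times (and the block $x_1+x_d,\ldots,x_{s-1}+x_d$ is empty if $s=1$). $f^n$ denotes the $n$-fold iterate of $f$ (with $f^0$ the identity), so $f^n(\underline{x})$ has length $d\,2^n$. For example $f((2,4,4,4))=(2,4,4,4,8,8,8,8)$. -}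

module Defs where

open import Data.Nat using (ℕ; zero; suc; _+_; _*_; _∸_; _≟_)
open import Data.List using (List; []; _∷_; _++_; map; take; replicate; length; last)
open import Data.Maybe using (Maybe; just; nothing)
open import Data.Bool using (if_then_else_)
open import Relation.Nullary.Decidable using (⌊_⌋)
open import Function using (_∘_)

-- sIdx c ys p : the largest (1-based, counting from p) position j in ys with
-- y_j ≠ c, or nothing if every entry of ys equals c.
sIdx : ℕ → List ℕ → ℕ → Maybe ℕ
sIdx c [] p = nothing
sIdx c (y ∷ ys) p with sIdx c ys (suc p)
... | just j  = just j
... | nothing = if ⌊ y ≟ c ⌋ then nothing else just p

-- The map f of the paper, on a sequence (x₁,…,x_d) given as a list.
-- (On the empty list, which is not in S, it returns [] ; irrelevant.)
f : List ℕ → List ℕ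
f [] = []
f xs@(x ∷ xs') with last xs
... | nothing = []
... | just xd with sIdx xd (take (length xs ∸ 1) xs) 1
...   | nothing = xs ++ replicate (length xs) (2 * xd)
...   | just s  = xs ++ (map (_+ xd) (take (s ∸ 1) xs)
                        ++ replicate (length xs ∸ s + 1) (2 * xd))

fIter : ℕ → List ℕ → List ℕ
fIter zero    xs = xs
fIter (suc n) xs = f (fIter n xs)

-- 0-based lookup: nth xs i is the (i+1)-th term of xs, if it exists
nth : List ℕ → ℕ → Maybe ℕ
nth []       _       = nothing
nth (y ∷ ys) zero    = just y
nth (y ∷ ys) (suc i) = nth ys i

-- f^(n+1)(x) = f(f^n(x)) begins with f^n(x) and is twice as long, so the iterates form a chain of
-- prefixes of lengths d·2^n. The k-th term is therefore the same in every iterate long enough to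
-- contain it, i.e. whenever k ≤ d·2^n; since k ≤ d·2^k this common value exists for every k.
module Submission where

open import Defs
open import Data.Nat using (ℕ; suc; zero; _*_; _^_; _≤_; _<_; _+_; _∸_; _≟_; _≤′_; >-nonZero; ≤′-refl; ≤′-step; z≤n; s≤s)
open import Data.Nat.Properties
open import Data.Vec using (Vec; toList)
open import Data.Vec.Properties using (length-toList)
open import Data.Maybe using (just; nothing)
open import Data.Maybe.Properties using (just-injective)
open import Data.Product using (Σ; ∃-syntax; _×_; _,_; proj₁; proj₂)
open import Data.Sum using (inj₁; inj₂)
open import Data.List using (List; []; _∷_; _++_; map; take; replicate; length; last)
open import Data.List.Properties
  using (length-++; length-map; length-take; length-replicate; ++-assoc; ++-identityʳ)
open import Relation.Binary.PropositionalEquality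
open import Relation.Nullary using (yes; no)

last-∷-isJust : ∀ (x : ℕ) xs → ∃[ v ] last (x ∷ xs) ≡ just v
last-∷-isJust x []       = x , refl
last-∷-isJust x (y ∷ ys) = last-∷-isJust y ys

sIdx-bounds : ∀ c ys p {j} → sIdx c ys p ≡ just j → p ≤ j × j < p + length ys
sIdx-bounds c []       p ()
sIdx-bounds c (y ∷ ys) p e with sIdx c ys (suc p) in e′
... | just k with sIdx-bounds c ys (suc p) e′
...   | p<k , k<1+p+n rewrite just-injective (sym e) =
          <⇒≤ p<k , subst (k <_) (sym (+-suc p (length ys))) k<1+p+n
sIdx-bounds c (y ∷ ys) p e | nothing with y ≟ c
... | yes _ with () <- e
... | no  _ with refl <- e = ≤-refl , m<m+n p (s≤s z≤n)

length-block : ∀ (ys : List ℕ) c z {s} → 1 ≤ s → s ≤ length ys →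
  length (map (_+ c) (take (s ∸ 1) ys) ++ replicate (length ys ∸ s + 1) z) ≡ length ys
length-block ys c z {suc t} _ s≤L = begin
  length (map (_+ c) (take t ys) ++ replicate (L ∸ suc t + 1) z)
    ≡⟨ length-++ (map (_+ c) (take t ys)) ⟩
  length (map (_+ c) (take t ys)) + length (replicate (L ∸ suc t + 1) z)
    ≡⟨ cong₂ _+_ length-prefix (length-replicate (L ∸ suc t + 1)) ⟩
  t + (L ∸ suc t + 1)   ≡⟨ cong (t +_) (+-comm (L ∸ suc t) 1) ⟩
  t + suc (L ∸ suc t)   ≡⟨ +-suc t (L ∸ suc t) ⟩
  suc t + (L ∸ suc t)   ≡⟨ m+[n∸m]≡n s≤L ⟩
  L                     ∎
  where
  open ≡-Reasoning
  L = length ys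
  length-prefix : length (map (_+ c) (take t ys)) ≡ t
  length-prefix = trans (length-map (_+ c) (take t ys))
                        (trans (length-take t ys) (m≤n⇒m⊓n≡m (<⇒≤ s≤L)))

f-extension : ∀ xs → ∃[ ys ] f xs ≡ xs ++ ys × length ys ≡ length xs
f-extension [] = [] , refl , refl
f-extension xs@(x ∷ xs′) with last xs in e
... | nothing with () <- trans (sym e) (proj₂ (last-∷-isJust x xs′))
... | just c with sIdx c (take (length xs′) xs) 1 in e′
...   | nothing = replicate (length xs) (2 * c) , refl , length-replicate (length xs)
...   | just s with sIdx-bounds c (take (length xs′) xs) 1 e′
...     | 1≤s , s<1+|prefix| = _ , refl , length-block xs c (2 * c) 1≤s
          (≤-trans (≤-pred s<1+|prefix|) (≤-trans (≤-reflexive (length-take (length xs′) xs)) (m⊓n≤n _ _)))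

length-f : ∀ xs → length (f xs) ≡ length xs * 2
length-f xs with f-extension xs
... | ys , f≡ , |ys|≡ = begin
  length (f xs)             ≡⟨ cong length f≡ ⟩
  length (xs ++ ys)         ≡⟨ length-++ xs ⟩
  length xs + length ys     ≡⟨ cong (length xs +_) |ys|≡ ⟩
  length xs + length xs     ≡⟨ cong (length xs +_) (sym (+-identityʳ (length xs))) ⟩
  2 * length xs             ≡⟨ *-comm 2 (length xs) ⟩
  length xs * 2             ∎
  where open ≡-Reasoning

length-fIter : ∀ n xs → length (fIter n xs) ≡ length xs * 2 ^ n
length-fIter zero    xs = sym (*-identityʳ (length xs))
length-fIter (suc n) xs = begin
  length (f (fIter n xs))   ≡⟨ length-f (fIter n xs) ⟩
  length (fIter n xs) * 2   ≡⟨ cong (_* 2) (length-fIter n xs) ⟩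
  length xs * 2 ^ n * 2     ≡⟨ *-assoc (length xs) (2 ^ n) 2 ⟩
  length xs * (2 ^ n * 2)   ≡⟨ cong (length xs *_) (*-comm (2 ^ n) 2) ⟩
  length xs * 2 ^ suc n     ∎
  where open ≡-Reasoning

fIter-extension : ∀ {m n} xs → m ≤′ n → ∃[ ys ] fIter n xs ≡ fIter m xs ++ ys
fIter-extension {m} xs ≤′-refl = [] , sym (++-identityʳ (fIter m xs))
fIter-extension {m} xs (≤′-step {n} m≤n) with fIter-extension xs m≤n
... | ys , eq with f-extension (fIter n xs)
...   | zs , f≡ , _ = ys ++ zs , trans f≡ (trans (cong (_++ zs) eq) (++-assoc (fIter m xs) ys zs))

nth-++ : ∀ xs ys {i v} → nth xs i ≡ just v → nth (xs ++ ys) i ≡ just v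
nth-++ (x ∷ xs) ys {zero}  eq = eq
nth-++ (x ∷ xs) ys {suc i} eq = nth-++ xs ys eq

nth-defined : ∀ xs {i} → i < length xs → ∃[ v ] nth xs i ≡ just v
nth-defined (x ∷ xs) {zero}  _          = x , refl
nth-defined (x ∷ xs) {suc i} (s≤s i<n) = nth-defined xs i<n

nth-fIter-mono : ∀ xs {m n i v} → m ≤ n → nth (fIter m xs) i ≡ just v → nth (fIter n xs) i ≡ just v
nth-fIter-mono xs {m} {i = i} {v} m≤n eq with fIter-extension xs (≤⇒≤′ m≤n)
... | ys , ext = subst (λ zs → nth zs i ≡ just v) (sym ext) (nth-++ (fIter m xs) ys eq)

nth-fIter-unique : ∀ xs {m n i v w} →
  nth (fIter m xs) i ≡ just v → nth (fIter n xs) i ≡ just w → v ≡ w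
nth-fIter-unique xs {m} {n} eqᵥ eqʷ with ≤-total m n
... | inj₁ m≤n = just-injective (trans (sym (nth-fIter-mono xs m≤n eqᵥ)) eqʷ)
... | inj₂ n≤m = just-injective (trans (sym eqᵥ) (nth-fIter-mono xs n≤m eqʷ))

n<2^n : ∀ n → n < 2 ^ n
n<2^n zero    = s≤s z≤n
n<2^n (suc n) = ≤-trans (+-mono-≤ (m^n>0 2 n) (n<2^n n))
                        (≤-reflexive (cong (2 ^ n +_) (sym (+-identityʳ (2 ^ n)))))

mainTheorem2 : (d : ℕ) → 1 ≤ d → (x : Vec ℕ d) →
    Σ (ℕ → ℕ) (λ X →
      ((i n : ℕ) → suc i ≤ d * 2 ^ n → nth (fIter n (toList x)) i ≡ just (X i))
      × ((Y : ℕ → ℕ) →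
          ((i n : ℕ) → suc i ≤ d * 2 ^ n → nth (fIter n (toList x)) i ≡ just (Y i)) →
          (i : ℕ) → Y i ≡ X i))
mainTheorem2 d 1≤d x = X , X-agrees , unique
  where
  xs = toList x

  term : ∀ {i} n → suc i ≤ d * 2 ^ n → ∃[ v ] nth (fIter n xs) i ≡ just v
  term n i<len = nth-defined (fIter n xs)
    (subst (_ ≤_) (sym (trans (length-fIter n xs) (cong (_* 2 ^ n) (length-toList x)))) i<len)

  i<d*2^i : ∀ i → suc i ≤ d * 2 ^ i
  i<d*2^i i = ≤-trans (n<2^n i) (m≤n*m (2 ^ i) d {{>-nonZero 1≤d}})

  X : ℕ → ℕ
  X i = proj₁ (term i (i<d*2^i i))

  X-agrees : (i n : ℕ) → suc i ≤ d * 2 ^ n → nth (fIter n xs) i ≡ just (X i)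
  X-agrees i n i<len with term n i<len
  ... | v , eq = subst (λ w → nth (fIter n xs) i ≡ just w)
                       (nth-fIter-unique xs {n} {i} eq (proj₂ (term i (i<d*2^i i)))) eq

  unique : (Y : ℕ → ℕ) → ((i n : ℕ) → suc i ≤ d * 2 ^ n → nth (fIter n xs) i ≡ just (Y i)) →
           (i : ℕ) → Y i ≡ X i
  unique Y Y-agrees i = just-injective (trans (sym (Y-agrees i i (i<d*2^i i))) (X-agrees i i (i<d*2^i i)))
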